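{- Each of the logics $\mathcal{D}$ and $\mathcal{I}$ is strictly contained in each of the logics $\mathcal{L}_{\mathsf{D}}$ and $\mathcal{L}_{\mathsf{I}}$. Here a team-semantics logic $L$ is strictly contained in a logic $L'$ with Kripke-style semantics if (1) for each formula $\varphi$ of $L$ there is a formula $\varphi'$ of $L'$ with $W\Vdash\varphi$ iff $W\models\varphi'$ for all SD-models $W$, and (2) there is a formula $\psi$ of $L'$ such that for every formula $\chi$ of $L$ some SD-model $W$ violates $W\models\psi\Leftrightarrow W\Vdash\chi$.
   Context: Fix a countably infinite set $\mathit{PROP}$ of proposition symbols; assignments are maps $w:\mathit{PROP}\to\{0,1\}$; an SD-model is a (possibly empty) set $W$ of assignments. $\mathcal{D}$: formulae $\varphi::=p\mid\neg p\mid\mathsf{D}(p_1,\dots,p_k;q)\mid\neg\mathsf{D}(p_1,\dots,p_k;q)\mid(\varphi\vee\varphi)\mid(\varphi\wedge\varphi)$, symbols in $\mathit{PROP}$, $k\in\mathbb{N}$. $\mathcal{I}$: formulae $\varphi::=p\mid\neg p\mid(p_1,\dots,p_k)\,\mathsf{I}_{(r_1,\dots,r_m)}(q_1,\dots,q_n)\mid(\varphi\vee\varphi)\mid(\varphi\wedge\varphi)$, $k,n\ge1,m\ge0$. Team semantics (common clauses): $W\Vdash p$ iff $w(p)=1$ for all $w\in W$; $W\Vdash\neg p$ iff $w(p)=0$ for all $w\in W$; $W\Vdash\varphi\wedge\psi$ iff both; $W\Vdash\varphi\vee\psi$ iff $W=U\cup V$ for some $U,V\subseteq W$ with $U\Vdash\varphi$,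 $V\Vdash\psi$. Atoms: $W\Vdash\mathsf{D}(p_1,\dots,p_k;q)$ iff all $u,v\in W$ with $u(p_i)=v(p_i)$ for all $i$ satisfy $u(q)=v(q)$; $W\Vdash\neg\mathsf{D}(p_1,\dots,p_k;q)$ iff $W=\emptyset$; $W\Vdash(p_1,\dots,p_k)\,\mathsf{I}_{(r_1,\dots,r_m)}(q_1,\dots,q_n)$ iff for all $w_1,w_2\in W$ agreeing on all $r_i$ there is $v\in W$ agreeing with $w_1$ on all $r_i$ and $p_i$ and with $w_2$ on all $q_i$. $\mathcal{L}_{\mathsf{D}}$: formulae $\varphi::=p\mid\neg\varphi\mid(\varphi\to\varphi)\mid\mathsf{D}(\varphi_1,\dots,\varphi_k;\psi)$; at $w\in W$: $W,w\models p$ iff $w(p)=1$; $\neg,\to$ classical; $W,w\models\mathsf{D}(\varphi_1,\dots,\varphi_k;\psi)$ iff all $u,v\in W$ agreeing on the truth of each $\varphi_i$ agree on the truth of $\psi$. $\mathcal{L}_{\mathsf{I}}$: formulae $\varphi::=p\mid\neg\varphi\mid(\varphi\to\varphi)\mid(\varphi_1,\dots,\varphi_k)\,\mathsf{I}_{(\theta_1,\dots,\theta_m)}(\psi_1,\dots,\psi_n)$ ($k,n\ge1$, $m\ge0$), with $W,w\models(\varphi_1,\dots,\varphi_k)\,\mathsf{I}_{(\theta_1,\dots,\theta_m)}(\psi_1,\dots,\psi_n)$ iff for all $w_1,w_2\in W$ agreeing on the truth of each $\theta_i$ there is $v\in W$ agreeing with $w_1$ on the truth of each $\theta_i$ and $\varphi_i$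 and with $w_2$ on the truth of each $\psi_i$; other clauses as for $\mathcal{L}_{\mathsf{D}}$. $W\models\varphi$ means $W,w\models\varphi$ for all $w\in W$. -}

module Defs where

open import Level using (Level; _⊔_) renaming (zero to 0ℓ; suc to lsuc)
open import Data.Nat using (ℕ)
open import Data.Bool using (Bool)
open import Data.List using (List; []; _∷_)
open import Data.List.NonEmpty using (List⁺; _∷_)
open import Data.Product using (_×_; Σ; ∃; _,_)
open import Data.Sum using (_⊎_)
open import Data.Unit using (⊤)
open import Relation.Nullary using (¬_)
open import Relation.Binary.PropositionalEquality using (_≡_)

PROP : Set
PROP = ℕ

Assignment : Set
Assignment = PROP → Bool

-- SD-models: (possibly empty, possibly infinite) sets of assignments,
-- represented as predicates on assignments.
SDModel : Set₁
SDModel = Assignment → Set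

Iff : ∀ {a b} → Set a → Set b → Set (a ⊔ b)
Iff A B = (A → B) × (B → A)

data DForm : Set where
  dvar  : PROP → DForm
  dnvar : PROP → DForm
  ddep  : List PROP → PROP → DForm
  dndep : List PROP → PROP → DForm
  _d∨_  : DForm → DForm → DForm
  _d∧_  : DForm → DForm → DForm

AgreeOn : Assignment → Assignment → List PROP → Set
AgreeOn u v []       = ⊤
AgreeOn u v (p ∷ ps) = (u p ≡ v p) × AgreeOn u v ps

AgreeOn⁺ : Assignment → Assignment → List⁺ PROP → Set
AgreeOn⁺ u v (p ∷ ps) = (u p ≡ v p) × AgreeOn u v ps

_⊆M_ : SDModel → SDModel → Set
U ⊆M W = ∀ w → U w → W w

IsUnion : SDModel → SDModel → SDModel → Set
IsUnion W U V = U ⊆M W × V ⊆M W × (∀ w → W w → U w ⊎ V w)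

infix 4 _⊩D_
_⊩D_ : SDModel → DForm → Set₁
W ⊩D dvar p    = Level.Lift (lsuc 0ℓ) (∀ w → W w → w p ≡ Bool.true)
W ⊩D dnvar p   = Level.Lift (lsuc 0ℓ) (∀ w → W w → w p ≡ Bool.false)
W ⊩D ddep ps q = Level.Lift (lsuc 0ℓ)
  (∀ u v → W u → W v → AgreeOn u v ps → u q ≡ v q)
W ⊩D dndep ps q = Level.Lift (lsuc 0ℓ) (∀ w → ¬ W w)
W ⊩D (φ d∨ ψ)  = Σ SDModel λ U → Σ SDModel λ V →
  IsUnion W U V × (U ⊩D φ) × (V ⊩D ψ)
W ⊩D (φ d∧ ψ)  = (W ⊩D φ) × (W ⊩D ψ)

data IForm : Set where
  ivar  : PROP → IForm
  invar : PROP → IForm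
  iind  : List⁺ PROP → List PROP → List⁺ PROP → IForm
  _i∨_  : IForm → IForm → IForm
  _i∧_  : IForm → IForm → IForm

infix 4 _⊩I_
_⊩I_ : SDModel → IForm → Set₁
W ⊩I ivar p  = Level.Lift (lsuc 0ℓ) (∀ w → W w → w p ≡ Bool.true)
W ⊩I invar p = Level.Lift (lsuc 0ℓ) (∀ w → W w → w p ≡ Bool.false)
W ⊩I iind ps rs qs = Level.Lift (lsuc 0ℓ)
  (∀ w₁ w₂ → W w₁ → W w₂ → AgreeOn w₁ w₂ rs →
    ∃ λ v → W v × AgreeOn v w₁ rs × AgreeOn⁺ v w₁ ps × AgreeOn⁺ v w₂ qs)
W ⊩I (φ i∨ ψ) = Σ SDModel λ U → Σ SDModel λ V →
  IsUnion W U V × (U ⊩I φ) × (V ⊩I ψ)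
W ⊩I (φ i∧ ψ) = (W ⊩I φ) × (W ⊩I ψ)

data LDForm : Set where
  var : PROP → LDForm
  neg : LDForm → LDForm
  imp : LDForm → LDForm → LDForm
  dep : List LDForm → LDForm → LDForm

mutual
  _,_⊨D_ : SDModel → Assignment → LDForm → Set
  W , w ⊨D var p     = w p ≡ Bool.true
  W , w ⊨D neg φ     = ¬ (W , w ⊨D φ)
  W , w ⊨D imp φ ψ   = W , w ⊨D φ → W , w ⊨D ψ
  W , w ⊨D dep φs ψ  = ∀ u v → W u → W v → AgreeD W u v φs →
                         Iff (W , u ⊨D ψ) (W , v ⊨D ψ)

  AgreeD : SDModel → Assignment → Assignment → List LDForm → Set
  AgreeD W u v []       = ⊤
  AgreeD W u v (φ ∷ φs) = Iff (W , u ⊨D φ) (W , v ⊨D φ) × AgreeD W u v φs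

infix 4 _⊨LD_
_⊨LD_ : SDModel → LDForm → Set
W ⊨LD φ = ∀ w → W w → W , w ⊨D φ

data LIForm : Set where
  var : PROP → LIForm
  neg : LIForm → LIForm
  imp : LIForm → LIForm → LIForm
  ind : List⁺ LIForm → List LIForm → List⁺ LIForm → LIForm

mutual
  _,_⊨I_ : SDModel → Assignment → LIForm → Set
  W , w ⊨I var p   = w p ≡ Bool.true
  W , w ⊨I neg φ   = ¬ (W , w ⊨I φ)
  W , w ⊨I imp φ ψ = W , w ⊨I φ → W , w ⊨I ψ
  W , w ⊨I ind φs θs ψs = ∀ w₁ w₂ → W w₁ → W w₂ → AgreeI W w₁ w₂ θs →
    ∃ λ v → W v × AgreeI W v w₁ θs × AgreeI⁺ W v w₁ φs × AgreeI⁺ W v w₂ ψs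

  AgreeI : SDModel → Assignment → Assignment → List LIForm → Set
  AgreeI W u v []       = ⊤
  AgreeI W u v (φ ∷ φs) = Iff (W , u ⊨I φ) (W , v ⊨I φ) × AgreeI W u v φs

  AgreeI⁺ : SDModel → Assignment → Assignment → List⁺ LIForm → Set
  AgreeI⁺ W u v (φ ∷ φs) = Iff (W , u ⊨I φ) (W , v ⊨I φ) × AgreeI W u v φs

infix 4 _⊨LI_
_⊨LI_ : SDModel → LIForm → Set
W ⊨LI φ = ∀ w → W w → W , w ⊨I φ

StrictlyContained : (F : Set) → (SDModel → F → Set₁) →
                    (G : Set) → (SDModel → G → Set) → Set₁
StrictlyContained F team G kripke =
  (∀ (φ : F) → Σ G λ φ' → ∀ (W : SDModel) → Iff (team W φ) (kripke W φ'))
  × (Σ G λ ψ → ∀ (χ : F) → Σ SDModel λ W → ¬ Iff (kripke W ψ) (team W χ))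

module Submission where

-- A formula χ of 𝒟 or ℐ only sees which valuations ("types") of its finitely many
-- variables occur in a team, and it holds on the empty team.  Classically, a Kripke
-- formula can ask whether some world has a given type: ◇ θ := ¬θ → ¬"θ is constant",
-- with D(;θ) resp. θ I θ expressing constancy.  A decision tree asking this for every
-- type, whose leaves say whether χ holds on the team of the types found, therefore
-- agrees with χ on all teams.  Conversely, "p is not constant" holds on a two-world
-- team but not on its singletons, whereas team formulas pass down to singletons.

open import Defs
open import Level using (lift; lower) renaming (zero to 0ℓ; suc to lsuc)
open import Function.Base using (id)
open import Data.Bool using (Bool; true; false)
open import Data.Bool.Properties using (¬-not; not-¬)
open import Data.Empty using (⊥; ⊥-elim)
open import Data.Unit using (tt)
open import Data.Product using (_×_; Σ; ∃; _,_; proj₁; proj₂)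
open import Data.Sum using (_⊎_; inj₁; inj₂; [_,_])
open import Data.List using (List; []; _∷_; _++_; map)
open import Data.List.NonEmpty using (toList) renaming (_∷_ to _∷⁺_)
open import Data.List.Membership.Propositional using (_∈_)
open import Data.List.Membership.Propositional.Properties using (∈-++⁺ˡ; ∈-++⁺ʳ; ∈-map⁺)
open import Data.List.Relation.Unary.Any using (here; there)
open import Data.List.Relation.Binary.Subset.Propositional using (_⊆_)
open import Data.List.Properties using (∷-injectiveˡ; ∷-injectiveʳ)
open import Relation.Nullary using (¬_; Dec; yes; no)
open import Relation.Nullary.Decidable using (map′; decidable-stable)
open import Relation.Unary using (Empty; Satisfiable; ∅; ｛_｝; _∪_; _≐_)
open import Relation.Unary.Properties using (≐-sym)
open import Relation.Binary.PropositionalEquality using (_≡_; refl; sym; trans; cong₂)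
open import Axiom.ExcludedMiddle using (ExcludedMiddle)

iff-trans : ∀ {a b c} {A : Set a} {B : Set b} {C : Set c} → Iff A B → Iff B C → Iff A C
iff-trans (f , g) (h , k) = (λ a → h (f a)) , (λ c → g (k c))

Agree : List PROP → Assignment → Assignment → Set
Agree X u v = ∀ {p} → p ∈ X → u p ≡ v p

agree-sym : ∀ {X u v} → Agree X u v → Agree X v u
agree-sym a m = sym (a m)

toAgreeOn : ∀ {u v} X → Agree X u v → AgreeOn u v X
toAgreeOn []      a = tt
toAgreeOn (p ∷ X) a = a (here refl) , toAgreeOn X (λ m → a (there m))

fromAgreeOn : ∀ {u v} X → AgreeOn u v X → Agree X u v
fromAgreeOn (p ∷ X) (e , a) (here refl) = e
fromAgreeOn (p ∷ X) (e , a) (there m)   = fromAgreeOn X a m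

agreeOn-resp : ∀ {u₁ u₂ v₁ v₂} X → Agree X u₁ u₂ → Agree X v₁ v₂ →
               AgreeOn u₁ v₁ X → AgreeOn u₂ v₂ X
agreeOn-resp X au av a =
  toAgreeOn X (λ m → trans (sym (au m)) (trans (fromAgreeOn X a m) (av m)))

_≈[_]_ : SDModel → List PROP → SDModel → Set
W ≈[ X ] W' = (∀ {w} → W w → ∃ λ w' → W' w' × Agree X w w')
            × (∀ {w'} → W' w' → ∃ λ w → W w × Agree X w' w)

≈-sym : ∀ {X W W'} → W ≈[ X ] W' → W' ≈[ X ] W
≈-sym (f , g) = g , f

≈-weaken : ∀ {X Y W W'} → Y ⊆ X → W ≈[ X ] W' → W ≈[ Y ] W'
≈-weaken Y⊆X (f , g) =
    (λ Ww → let (w' , W'w' , a) = f Ww in w' , W'w' , λ m → a (Y⊆X m))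
  , (λ W'w' → let (w , Ww , a) = g W'w' in w , Ww , λ m → a (Y⊆X m))

≐⇒≈ : ∀ {X W W'} → W ≐ W' → W ≈[ X ] W'
≐⇒≈ (f , g) = (λ Ww → _ , f Ww , λ _ → refl) , (λ W'w' → _ , g W'w' , λ _ → refl)

≈-split : ∀ {X W W' U V} → W ≈[ X ] W' → IsUnion W U V →
          Σ SDModel λ U' → Σ SDModel λ V' →
            IsUnion W' U' V' × U ≈[ X ] U' × V ≈[ X ] V'
≈-split {X} {W} {W'} {U} {V} (f , g) (U⊆W , V⊆W , cover) =
  shadow U , shadow V , ((λ _ → proj₁) , (λ _ → proj₁) , cover') ,
  shadow-≈ U U⊆W , shadow-≈ V V⊆W
  where
  shadow : SDModel → SDModel
  shadow S w' = W' w' × ∃ λ w → S w × Agree X w' w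

  shadow-≈ : ∀ S → S ⊆M W → S ≈[ X ] shadow S
  shadow-≈ S S⊆W =
      (λ {w} Sw → let (w' , W'w' , a) = f (S⊆W w Sw)
                  in w' , (W'w' , w , Sw , agree-sym a) , a)
    , (λ (_ , w , Sw , a) → w , Sw , a)

  cover' : ∀ w' → W' w' → shadow U w' ⊎ shadow V w'
  cover' w' W'w' with g W'w'
  ... | w , Ww , a with cover w Ww
  ...   | inj₁ Uw = inj₁ (W'w' , w , Uw , a)
  ...   | inj₂ Vw = inj₂ (W'w' , w , Vw , a)

literal-resp-≈ : ∀ {p b W W'} → W ≈[ p ∷ [] ] W' →
                 (∀ w → W w → w p ≡ b) → ∀ w' → W' w' → w' p ≡ b
literal-resp-≈ (_ , g) h w' W'w' =
  let (w , Ww , a) = g W'w' in trans (a (here refl)) (h w Ww)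

union-∅ʳ : ∀ {W} → IsUnion W W ∅
union-∅ʳ = (λ _ → id) , (λ _ ()) , (λ _ → inj₁)

union-∅ˡ : ∀ {W} → IsUnion W ∅ W
union-∅ˡ = (λ _ ()) , (λ _ → id) , (λ _ → inj₂)

Constant : SDModel → (Assignment → Set) → Set
Constant W P = ∀ {u v} → W u → W v → Iff (P u) (P v)

record TeamLogic : Set₂ where
  field
    Form        : Set
    _⊩_         : SDModel → Form → Set₁
    vars        : Form → List PROP
    ⊩-resp-≈    : ∀ χ {W W'} → W ≈[ vars χ ] W' → W ⊩ χ → W' ⊩ χ
    ⊩-empty     : ∀ χ {W} → Empty W → W ⊩ χ
    ⊩-singleton : ∀ χ {W w} → W w → W ⊩ χ → ｛ w ｝ ⊩ χ

record KripkeLogic : Set₁ where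
  infix  30 ¬′_
  infixr 25 _⇒′_
  field
    Form    : Set
    _,_⊨_   : SDModel → Assignment → Form → Set
    atom    : PROP → Form
    ¬′_     : Form → Form
    _⇒′_    : Form → Form → Form
    const   : Form → Form
    ⊨-atom   : ∀ {W w p} → Iff (W , w ⊨ atom p) (w p ≡ true)
    ⊨-¬′   : ∀ {W w φ} → Iff (W , w ⊨ ¬′ φ) (¬ W , w ⊨ φ)
    ⊨-⇒′   : ∀ {W w φ ψ} → Iff (W , w ⊨ φ ⇒′ ψ) (W , w ⊨ φ → W , w ⊨ ψ)
    ⊨-const : ∀ {W w φ} → Iff (W , w ⊨ const φ) (Constant W (λ u → W , u ⊨ φ))

  Valid : SDModel → Form → Set
  Valid W φ = ∀ w → W w → W , w ⊨ φ

varsD : DForm → List PROP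
varsD (dvar p)     = p ∷ []
varsD (dnvar p)    = p ∷ []
varsD (ddep ps q)  = q ∷ ps
varsD (dndep ps q) = []
varsD (φ d∨ ψ)     = varsD φ ++ varsD ψ
varsD (φ d∧ ψ)     = varsD φ ++ varsD ψ

⊩D-resp-≈ : ∀ χ {W W'} → W ≈[ varsD χ ] W' → W ⊩D χ → W' ⊩D χ
⊩D-resp-≈ (dvar p)  e (lift h) = lift (literal-resp-≈ e h)
⊩D-resp-≈ (dnvar p) e (lift h) = lift (literal-resp-≈ e h)
⊩D-resp-≈ (ddep ps q) (_ , g) (lift h) = lift λ u' v' W'u' W'v' a' →
  let (u , Wu , au) = g W'u'
      (v , Wv , av) = g W'v'
      a = agreeOn-resp ps (λ m → au (there m)) (λ m → av (there m)) a'
  in trans (au (here refl)) (trans (h u v Wu Wv a) (sym (av (here refl))))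
⊩D-resp-≈ (dndep ps q) (_ , g) (lift h) = lift λ w' W'w' → h _ (proj₁ (proj₂ (g W'w')))
⊩D-resp-≈ (φ d∨ ψ) e (U , V , W=U∪V , hU , hV) =
  let (U' , V' , W'=U'∪V' , eU , eV) = ≈-split e W=U∪V
  in U' , V' , W'=U'∪V' ,
     ⊩D-resp-≈ φ (≈-weaken ∈-++⁺ˡ eU) hU ,
     ⊩D-resp-≈ ψ (≈-weaken (∈-++⁺ʳ (varsD φ)) eV) hV
⊩D-resp-≈ (φ d∧ ψ) e (hφ , hψ) =
  ⊩D-resp-≈ φ (≈-weaken ∈-++⁺ˡ e) hφ , ⊩D-resp-≈ ψ (≈-weaken (∈-++⁺ʳ (varsD φ)) e) hψ

⊩D-empty : ∀ χ {W} → Empty W → W ⊩D χ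
⊩D-empty (dvar p)     e = lift λ w Ww → ⊥-elim (e w Ww)
⊩D-empty (dnvar p)    e = lift λ w Ww → ⊥-elim (e w Ww)
⊩D-empty (ddep ps q)  e = lift λ u _ Wu _ _ → ⊥-elim (e u Wu)
⊩D-empty (dndep ps q) e = lift e
⊩D-empty (φ d∨ ψ)     e = _ , ∅ , union-∅ʳ , ⊩D-empty φ e , ⊩D-empty ψ λ _ ()
⊩D-empty (φ d∧ ψ)     e = ⊩D-empty φ e , ⊩D-empty ψ e

⊩D-singleton : ∀ χ {W w} → W w → W ⊩D χ → ｛ w ｝ ⊩D χ
⊩D-singleton (dvar p)     Ww (lift h) = lift λ { _ refl → h _ Ww }
⊩D-singleton (dnvar p)    Ww (lift h) = lift λ { _ refl → h _ Ww }
⊩D-singleton (ddep ps q)  Ww _ = lift λ { _ _ refl refl _ → refl }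
⊩D-singleton (dndep ps q) Ww (lift h) = ⊥-elim (h _ Ww)
⊩D-singleton (φ d∨ ψ) {w = w} Ww (U , V , (_ , _ , cover) , hU , hV) with cover w Ww
... | inj₁ Uw = ｛ w ｝ , ∅ , union-∅ʳ , ⊩D-singleton φ Uw hU , ⊩D-empty ψ λ _ ()
... | inj₂ Vw = ∅ , ｛ w ｝ , union-∅ˡ , ⊩D-empty φ (λ _ ()) , ⊩D-singleton ψ Vw hV
⊩D-singleton (φ d∧ ψ) Ww (hφ , hψ) = ⊩D-singleton φ Ww hφ , ⊩D-singleton ψ Ww hψ

𝒟 : TeamLogic
𝒟 = record
  { Form = DForm ; _⊩_ = _⊩D_ ; vars = varsD
  ; ⊩-resp-≈ = ⊩D-resp-≈ ; ⊩-empty = ⊩D-empty ; ⊩-singleton = ⊩D-singleton }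

varsI : IForm → List PROP
varsI (ivar p)        = p ∷ []
varsI (invar p)       = p ∷ []
varsI (iind ps rs qs) = toList ps ++ rs ++ toList qs
varsI (φ i∨ ψ)        = varsI φ ++ varsI ψ
varsI (φ i∧ ψ)        = varsI φ ++ varsI ψ

⊩I-resp-≈ : ∀ χ {W W'} → W ≈[ varsI χ ] W' → W ⊩I χ → W' ⊩I χ
⊩I-resp-≈ (ivar p)  e (lift h) = lift (literal-resp-≈ e h)
⊩I-resp-≈ (invar p) e (lift h) = lift (literal-resp-≈ e h)
⊩I-resp-≈ (iind (p ∷⁺ ps) rs (q ∷⁺ qs)) (f , g) (lift h) = lift λ w₁' w₂' W'w₁' W'w₂' a' →
  let P = p ∷ ps
      Q = q ∷ qs
      onP : P ⊆ varsI (iind (p ∷⁺ ps) rs (q ∷⁺ qs))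
      onP = ∈-++⁺ˡ
      onR : rs ⊆ varsI (iind (p ∷⁺ ps) rs (q ∷⁺ qs))
      onR m = ∈-++⁺ʳ P (∈-++⁺ˡ m)
      onQ : Q ⊆ varsI (iind (p ∷⁺ ps) rs (q ∷⁺ qs))
      onQ m = ∈-++⁺ʳ P (∈-++⁺ʳ rs m)
      (w₁ , Ww₁ , a₁) = g W'w₁'
      (w₂ , Ww₂ , a₂) = g W'w₂'
      (v , Wv , vR , vP , vQ) =
        h w₁ w₂ Ww₁ Ww₂ (agreeOn-resp rs (λ m → a₁ (onR m)) (λ m → a₂ (onR m)) a')
      (v' , W'v' , av) = f Wv
      a₁⁻ = agree-sym a₁
  in v' , W'v' ,
     agreeOn-resp rs (λ m → av (onR m)) (λ m → a₁⁻ (onR m)) vR ,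
     agreeOn-resp P (λ m → av (onP m)) (λ m → a₁⁻ (onP m)) vP ,
     agreeOn-resp Q (λ m → av (onQ m)) (λ m → agree-sym a₂ (onQ m)) vQ
⊩I-resp-≈ (φ i∨ ψ) e (U , V , W=U∪V , hU , hV) =
  let (U' , V' , W'=U'∪V' , eU , eV) = ≈-split e W=U∪V
  in U' , V' , W'=U'∪V' ,
     ⊩I-resp-≈ φ (≈-weaken ∈-++⁺ˡ eU) hU ,
     ⊩I-resp-≈ ψ (≈-weaken (∈-++⁺ʳ (varsI φ)) eV) hV
⊩I-resp-≈ (φ i∧ ψ) e (hφ , hψ) =
  ⊩I-resp-≈ φ (≈-weaken ∈-++⁺ˡ e) hφ , ⊩I-resp-≈ ψ (≈-weaken (∈-++⁺ʳ (varsI φ)) e) hψ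

⊩I-empty : ∀ χ {W} → Empty W → W ⊩I χ
⊩I-empty (ivar p)        e = lift λ w Ww → ⊥-elim (e w Ww)
⊩I-empty (invar p)       e = lift λ w Ww → ⊥-elim (e w Ww)
⊩I-empty (iind ps rs qs) e = lift λ w₁ _ Ww₁ _ _ → ⊥-elim (e w₁ Ww₁)
⊩I-empty (φ i∨ ψ)        e = _ , ∅ , union-∅ʳ , ⊩I-empty φ e , ⊩I-empty ψ λ _ ()
⊩I-empty (φ i∧ ψ)        e = ⊩I-empty φ e , ⊩I-empty ψ e

⊩I-singleton : ∀ χ {W w} → W w → W ⊩I χ → ｛ w ｝ ⊩I χ
⊩I-singleton (ivar p)  Ww (lift h) = lift λ { _ refl → h _ Ww }
⊩I-singleton (invar p) Ww (lift h) = lift λ { _ refl → h _ Ww }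
⊩I-singleton (iind (p ∷⁺ ps) rs (q ∷⁺ qs)) {w = w} Ww _ = lift λ { _ _ refl refl _ →
  w , refl , toAgreeOn rs (λ _ → refl) , toAgreeOn (p ∷ ps) (λ _ → refl) ,
  toAgreeOn (q ∷ qs) (λ _ → refl) }
⊩I-singleton (φ i∨ ψ) {w = w} Ww (U , V , (_ , _ , cover) , hU , hV) with cover w Ww
... | inj₁ Uw = ｛ w ｝ , ∅ , union-∅ʳ , ⊩I-singleton φ Uw hU , ⊩I-empty ψ λ _ ()
... | inj₂ Vw = ∅ , ｛ w ｝ , union-∅ˡ , ⊩I-empty φ (λ _ ()) , ⊩I-singleton ψ Vw hV
⊩I-singleton (φ i∧ ψ) Ww (hφ , hψ) = ⊩I-singleton φ Ww hφ , ⊩I-singleton ψ Ww hψ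

ℐ : TeamLogic
ℐ = record
  { Form = IForm ; _⊩_ = _⊩I_ ; vars = varsI
  ; ⊩-resp-≈ = ⊩I-resp-≈ ; ⊩-empty = ⊩I-empty ; ⊩-singleton = ⊩I-singleton }

ℒD : KripkeLogic
ℒD = record
  { Form = LDForm ; _,_⊨_ = _,_⊨D_
  ; atom = LDForm.var ; ¬′_ = LDForm.neg ; _⇒′_ = LDForm.imp ; const = dep []
  ; ⊨-atom = id , id ; ⊨-¬′ = id , id ; ⊨-⇒′ = id , id
  ; ⊨-const = (λ h Wu Wv → h _ _ Wu Wv tt) , (λ c _ _ Wu Wv _ → c Wu Wv) }

ℒI : KripkeLogic
ℒI = record
  { Form = LIForm ; _,_⊨_ = _,_⊨I_
  ; atom = LIForm.var ; ¬′_ = LIForm.neg ; _⇒′_ = LIForm.imp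
  ; const = λ θ → ind (θ ∷⁺ []) [] (θ ∷⁺ [])
  ; ⊨-atom = id , id ; ⊨-¬′ = id , id ; ⊨-⇒′ = id , id
  ; ⊨-const = λ {W} {w} → const⇒constant {W} {w} , constant⇒const {W} {w} }
  where
  const⇒constant : ∀ {W w θ} → W , w ⊨I ind (θ ∷⁺ []) [] (θ ∷⁺ []) →
                   Constant W (λ u → W , u ⊨I θ)
  const⇒constant h Wu Wv =
    let (_ , _ , _ , (v~u , _) , (v~w , _)) = h _ _ Wu Wv tt
    in (λ t → proj₁ v~w (proj₂ v~u t)) , (λ t → proj₁ v~u (proj₂ v~w t))

  constant⇒const : ∀ {W w θ} → Constant W (λ u → W , u ⊨I θ) →
                   W , w ⊨I ind (θ ∷⁺ []) [] (θ ∷⁺ [])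
  constant⇒const c w₁ _ Ww₁ Ww₂ _ = w₁ , Ww₁ , tt , ((id , id) , tt) , (c Ww₁ Ww₂ , tt)

module ClassicalConnectives (em : ExcludedMiddle (lsuc 0ℓ)) (K : KripkeLogic) where
  open KripkeLogic K

  decide : {P : Set} → Dec P
  decide = map′ lower lift em

  ⊤′ ⊥′ : Form
  ⊤′ = atom 0 ⇒′ atom 0
  ⊥′ = ¬′ ⊤′

  infixr 27 _∧′_
  infixr 26 _∨′_
  infix  24 if′_then_else_
  _∧′_ _∨′_ : Form → Form → Form
  φ ∧′ ψ = ¬′ (φ ⇒′ ¬′ ψ)
  φ ∨′ ψ = ¬′ φ ⇒′ ψ

  if′_then_else_ : Form → Form → Form → Form
  if′ φ then ψ else ρ = (φ ∧′ ψ) ∨′ (¬′ φ ∧′ ρ)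

  ◇ : Form → Form
  ◇ θ = ¬′ θ ⇒′ ¬′ const θ

  verdict : {A : Set₁} → Dec A → Form
  verdict (yes _) = ⊤′
  verdict (no _)  = ⊥′

  module _ {W : SDModel} {w : Assignment} where
    ⊨-⊤′ : W , w ⊨ ⊤′
    ⊨-⊤′ = proj₂ ⊨-⇒′ id

    ⊭-⊥′ : ¬ W , w ⊨ ⊥′
    ⊭-⊥′ h = proj₁ ⊨-¬′ h ⊨-⊤′

    ⊨-∧′ : ∀ {φ ψ} → Iff (W , w ⊨ φ ∧′ ψ) (W , w ⊨ φ × W , w ⊨ ψ)
    ⊨-∧′ = (λ h → let ¬φ⇒¬ψ = proj₁ ⊨-¬′ h in
               decidable-stable decide (λ ¬a → ¬φ⇒¬ψ (proj₂ ⊨-⇒′ λ a → ⊥-elim (¬a a)))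
             , decidable-stable decide (λ ¬b → ¬φ⇒¬ψ (proj₂ ⊨-⇒′ λ _ → proj₂ ⊨-¬′ ¬b)))
         , (λ (a , b) → proj₂ ⊨-¬′ λ i → proj₁ ⊨-¬′ (proj₁ ⊨-⇒′ i a) b)

    ⊨-∨′ : ∀ {φ ψ} → Iff (W , w ⊨ φ ∨′ ψ) (W , w ⊨ φ ⊎ W , w ⊨ ψ)
    ⊨-∨′ {φ} = (λ h → case (decide {W , w ⊨ φ}) h) , λ
      { (inj₁ a) → proj₂ ⊨-⇒′ λ ¬a → ⊥-elim (proj₁ ⊨-¬′ ¬a a)
      ; (inj₂ b) → proj₂ ⊨-⇒′ λ _ → b }
      where
      case : ∀ {ψ} → Dec (W , w ⊨ φ) → W , w ⊨ φ ∨′ ψ → W , w ⊨ φ ⊎ W , w ⊨ ψ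
      case (yes a) _ = inj₁ a
      case (no ¬a) h = inj₂ (proj₁ ⊨-⇒′ h (proj₂ ⊨-¬′ ¬a))

    ⊨-verdict : ∀ {A} (d : Dec A) → Iff (W , w ⊨ verdict d) A
    ⊨-verdict (yes a) = (λ _ → a) , (λ _ → ⊨-⊤′)
    ⊨-verdict (no ¬a) = (λ h → ⊥-elim (⊭-⊥′ h)) , (λ a → ⊥-elim (¬a a))

    ⊨-if′-yes : ∀ {φ ψ ρ} → W , w ⊨ φ → Iff (W , w ⊨ if′ φ then ψ else ρ) (W , w ⊨ ψ)
    ⊨-if′-yes a =
        (λ h → [ (λ h → proj₂ (proj₁ ⊨-∧′ h))
               , (λ h → ⊥-elim (proj₁ ⊨-¬′ (proj₁ (proj₁ ⊨-∧′ h)) a)) ] (proj₁ ⊨-∨′ h))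
      , (λ b → proj₂ ⊨-∨′ (inj₁ (proj₂ ⊨-∧′ (a , b))))

    ⊨-if′-no : ∀ {φ ψ ρ} → ¬ W , w ⊨ φ → Iff (W , w ⊨ if′ φ then ψ else ρ) (W , w ⊨ ρ)
    ⊨-if′-no ¬a =
        (λ h → [ (λ h → ⊥-elim (¬a (proj₁ (proj₁ ⊨-∧′ h))))
               , (λ h → proj₂ (proj₁ ⊨-∧′ h)) ] (proj₁ ⊨-∨′ h))
      , (λ c → proj₂ ⊨-∨′ (inj₂ (proj₂ ⊨-∧′ (proj₂ ⊨-¬′ ¬a , c))))

    -- If θ holds nowhere it is constant, and then ◇ θ fails at w.
    ⊨-◇ : ∀ {θ} → W w → Iff (W , w ⊨ ◇ θ) (∃ λ u → W u × W , u ⊨ θ)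
    ⊨-◇ Ww =
        (λ h → decidable-stable decide λ nowhere →
           proj₁ ⊨-¬′ (proj₁ ⊨-⇒′ h (proj₂ ⊨-¬′ λ t → nowhere (_ , Ww , t)))
             (proj₂ ⊨-const λ Wu Wv → (λ t → ⊥-elim (nowhere (_ , Wu , t)))
                                    , (λ t → ⊥-elim (nowhere (_ , Wv , t)))))
      , (λ (u , Wu , t) → proj₂ ⊨-⇒′ λ ¬θ → proj₂ ⊨-¬′ λ c →
           proj₁ ⊨-¬′ ¬θ (proj₁ (proj₁ ⊨-const c Wu Ww) t))

typeOf : List PROP → Assignment → List Bool
typeOf X u = map u X

allTypes : List PROP → List (List Bool)
allTypes []      = [] ∷ []
allTypes (x ∷ X) = map (true ∷_) (allTypes X) ++ map (false ∷_) (allTypes X)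

typeOf∈allTypes : ∀ X u → typeOf X u ∈ allTypes X
typeOf∈allTypes []      u = here refl
typeOf∈allTypes (x ∷ X) u with u x
... | true  = ∈-++⁺ˡ (∈-map⁺ (true ∷_) (typeOf∈allTypes X u))
... | false = ∈-++⁺ʳ (map (true ∷_) (allTypes X)) (∈-map⁺ (false ∷_) (typeOf∈allTypes X u))

typeOf-≡⇒Agree : ∀ {u v} X → typeOf X u ≡ typeOf X v → Agree X u v
typeOf-≡⇒Agree (x ∷ X) eq (here refl) = ∷-injectiveˡ eq
typeOf-≡⇒Agree (x ∷ X) eq (there m)   = typeOf-≡⇒Agree X (∷-injectiveʳ eq) m

module Translation (em : ExcludedMiddle (lsuc 0ℓ)) (K : KripkeLogic) (T : TeamLogic) where
  open KripkeLogic K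
  open ClassicalConnectives em K
  open TeamLogic T using (_⊩_; vars; ⊩-resp-≈; ⊩-empty) renaming (Form to TeamForm)

  hasType : List PROP → List Bool → Form
  hasType []      []           = ⊤′
  hasType (x ∷ X) (true ∷ s)  = atom x ∧′ hasType X s
  hasType (x ∷ X) (false ∷ s) = ¬′ atom x ∧′ hasType X s
  hasType _       _            = ⊥′

  module _ {W : SDModel} {u : Assignment} where
    ⊨-hasType-typeOf : ∀ X → W , u ⊨ hasType X (typeOf X u)
    ⊨-hasType-typeOf []      = ⊨-⊤′
    ⊨-hasType-typeOf (x ∷ X) with u x in ux
    ... | true  = proj₂ ⊨-∧′ (proj₂ ⊨-atom ux , ⊨-hasType-typeOf X)
    ... | false = proj₂ ⊨-∧′ (proj₂ ⊨-¬′ (λ t → not-¬ ux (proj₁ ⊨-atom t)) , ⊨-hasType-typeOf X)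

    ⊨-hasType : ∀ X s → Iff (W , u ⊨ hasType X s) (typeOf X u ≡ s)
    ⊨-hasType X s = to X s , λ { refl → ⊨-hasType-typeOf X }
      where
      to : ∀ X s → W , u ⊨ hasType X s → typeOf X u ≡ s
      to []      []          _ = refl
      to []      (_ ∷ _)     h = ⊥-elim (⊭-⊥′ h)
      to (x ∷ X) []          h = ⊥-elim (⊭-⊥′ h)
      to (x ∷ X) (true ∷ s)  h =
        let (t , h') = proj₁ ⊨-∧′ h in cong₂ _∷_ (proj₁ ⊨-atom t) (to X s h')
      to (x ∷ X) (false ∷ s) h =
        let (f , h') = proj₁ ⊨-∧′ h
        in cong₂ _∷_ (¬-not λ t → proj₁ ⊨-¬′ f (proj₂ ⊨-atom t)) (to X s h')

  module _ (χ : TeamForm) where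
    X : List PROP
    X = vars χ

    ⊩-resp-≐ : ∀ {A B} → A ≐ B → Iff (A ⊩ χ) (B ⊩ χ)
    ⊩-resp-≐ A≐B = ⊩-resp-≈ χ (≐⇒≈ A≐B) , ⊩-resp-≈ χ (≐⇒≈ (≐-sym A≐B))

    TypesIn : List (List Bool) → SDModel
    TypesIn S u = typeOf X u ∈ S

    Realised : SDModel → List Bool → Set
    Realised W s = ∃ λ u → W u × typeOf X u ≡ s

    -- The invariant of the decision tree: the types in acc were found realised, those
    -- in Ts are still to be asked about.
    TypeTeam : SDModel → List (List Bool) → List (List Bool) → SDModel
    TypeTeam W acc Ts u = TypesIn acc u ⊎ (TypesIn Ts u × Realised W (typeOf X u))

    typeTree : List (List Bool) → List (List Bool) → Form
    typeTree acc []       = verdict (em {TypesIn acc ⊩ χ})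
    typeTree acc (s ∷ Ts) = if′ ◇ (hasType X s) then typeTree (s ∷ acc) Ts else typeTree acc Ts

    module _ {W : SDModel} where
      TypeTeam-[] : ∀ {acc} → TypeTeam W acc [] ≐ TypesIn acc
      TypeTeam-[] = (λ { (inj₁ m) → m }) , inj₁

      TypeTeam-realised : ∀ {acc s Ts} → Realised W s →
                          TypeTeam W acc (s ∷ Ts) ≐ TypeTeam W (s ∷ acc) Ts
      TypeTeam-realised r =
          (λ { (inj₁ m) → inj₁ (there m) ; (inj₂ (here refl , _)) → inj₁ (here refl)
             ; (inj₂ (there m , r')) → inj₂ (m , r') })
        , (λ { (inj₁ (here refl)) → inj₂ (here refl , r) ; (inj₁ (there m)) → inj₁ m
             ; (inj₂ (m , r')) → inj₂ (there m , r') })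

      TypeTeam-unrealised : ∀ {acc s Ts} → ¬ Realised W s →
                            TypeTeam W acc (s ∷ Ts) ≐ TypeTeam W acc Ts
      TypeTeam-unrealised ¬r =
          (λ { (inj₁ m) → inj₁ m ; (inj₂ (here refl , r)) → ⊥-elim (¬r r)
             ; (inj₂ (there m , r)) → inj₂ (m , r) })
        , (λ { (inj₁ m) → inj₁ m ; (inj₂ (m , r)) → inj₂ (there m , r) })

      TypeTeam-allTypes : TypeTeam W [] (allTypes X) ≈[ X ] W
      TypeTeam-allTypes =
          (λ { (inj₂ (_ , w , Ww , eq)) → w , Ww , typeOf-≡⇒Agree X (sym eq) })
        , (λ {w} Ww → w , inj₂ (typeOf∈allTypes X w , w , Ww , refl) , λ _ → refl)

      ⊨-◇hasType : ∀ {w s} → W w → Iff (W , w ⊨ ◇ (hasType X s)) (Realised W s)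
      ⊨-◇hasType Ww =
          (λ h → let (u , Wu , t) = proj₁ (⊨-◇ Ww) h in u , Wu , proj₁ (⊨-hasType X _) t)
        , (λ (u , Wu , eq) → proj₂ (⊨-◇ Ww) (u , Wu , proj₂ (⊨-hasType X _) eq))

      typeTree-correct : ∀ {w} acc Ts → W w →
                         Iff (W , w ⊨ typeTree acc Ts) (TypeTeam W acc Ts ⊩ χ)
      typeTree-correct acc [] _ =
        iff-trans (⊨-verdict em) (⊩-resp-≐ (≐-sym TypeTeam-[]))
      typeTree-correct acc (s ∷ Ts) Ww with decide {Realised W s}
      ... | yes r = iff-trans (⊨-if′-yes (proj₂ (⊨-◇hasType Ww) r))
                      (iff-trans (typeTree-correct (s ∷ acc) Ts Ww)
                                 (⊩-resp-≐ (≐-sym (TypeTeam-realised r))))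
      ... | no ¬r = iff-trans (⊨-if′-no (λ h → ¬r (proj₁ (⊨-◇hasType Ww) h)))
                      (iff-trans (typeTree-correct acc Ts Ww)
                                 (⊩-resp-≐ (≐-sym (TypeTeam-unrealised ¬r))))

    translation : Σ Form λ φ → ∀ W → Iff (W ⊩ χ) (Valid W φ)
    translation = typeTree [] (allTypes X) , λ W →
        (λ t w Ww → proj₂ (typeTree-correct [] _ Ww) (⊩-resp-≈ χ (≈-sym TypeTeam-allTypes) t))
      , (λ h → from h decide)
      where
      from : ∀ {W} → Valid W (typeTree [] (allTypes X)) → Dec (Satisfiable W) → W ⊩ χ
      from h (yes (w , Ww)) =
        ⊩-resp-≈ χ TypeTeam-allTypes (proj₁ (typeTree-correct [] _ Ww) (h w Ww))
      from h (no ¬sat)      = ⊩-empty χ λ w Ww → ¬sat (w , Ww)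

module Separation (em : ExcludedMiddle (lsuc 0ℓ)) (K : KripkeLogic) (T : TeamLogic) where
  open KripkeLogic K
  open TeamLogic T using (_⊩_; ⊩-singleton)

  nonConstant : Form
  nonConstant = ¬′ const (atom 0)

  allFalse allTrue : Assignment
  allFalse _ = false
  allTrue  _ = true

  Valid-nonConstant : Valid (｛ allFalse ｝ ∪ ｛ allTrue ｝) nonConstant
  Valid-nonConstant _ _ = proj₂ ⊨-¬′ λ c →
    let allFalse⊨p₀ = proj₁ (proj₁ ⊨-const c (inj₂ refl) (inj₁ refl)) (proj₂ ⊨-atom refl)
    in false≢true (proj₁ ⊨-atom allFalse⊨p₀)
    where
    false≢true : false ≡ true → ⊥
    false≢true ()

  ¬Valid-nonConstant : ¬ Valid ｛ allFalse ｝ nonConstant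
  ¬Valid-nonConstant h = proj₁ ⊨-¬′ (h allFalse refl) (proj₂ ⊨-const λ { refl refl → id , id })

  separation : Σ Form λ ψ → ∀ χ → Σ SDModel λ W → ¬ Iff (Valid W ψ) (W ⊩ χ)
  separation = nonConstant , λ χ → separate χ em
    where
    separate : ∀ χ → Dec ((｛ allFalse ｝ ∪ ｛ allTrue ｝) ⊩ χ) →
               Σ SDModel λ W → ¬ Iff (Valid W nonConstant) (W ⊩ χ)
    separate χ (yes h) = ｛ allFalse ｝ , λ i →
      ¬Valid-nonConstant (proj₂ i (⊩-singleton χ (inj₁ refl) h))
    separate χ (no ¬h) = ｛ allFalse ｝ ∪ ｛ allTrue ｝ , λ i → ¬h (proj₁ i Valid-nonConstant)

strictlyContained : ExcludedMiddle (lsuc 0ℓ) → (T : TeamLogic) (K : KripkeLogic) →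
  StrictlyContained (TeamLogic.Form T) (TeamLogic._⊩_ T)
                    (KripkeLogic.Form K) (KripkeLogic.Valid K)
strictlyContained em T K = Translation.translation em K T , Separation.separation em K T

corollary6p5 : ExcludedMiddle (lsuc 0ℓ) →
    StrictlyContained DForm _⊩D_ LDForm _⊨LD_
    × StrictlyContained DForm _⊩D_ LIForm _⊨LI_
    × StrictlyContained IForm _⊩I_ LDForm _⊨LD_
    × StrictlyContained IForm _⊩I_ LIForm _⊨LI_
corollary6p5 em =
    strictlyContained em 𝒟 ℒD
  , strictlyContained em 𝒟 ℒI
  , strictlyContained em ℐ ℒD
  , strictlyContained em ℐ ℒI
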